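{- A ring map $B\to R$ from a Boolean ring $B$ to a (commutative) ring $R$ is faithfully flat if and only if it is injective.
   Context: A Boolean ring is a ring in which every element is idempotent. -}

module Defs where

open import Level using (Level; _⊔_; Setω)
open import Algebra.Bundles using (Ring; CommutativeRing)
open import Algebra.Module.Bundles using (LeftModule)
open import Algebra.Module.Morphism.Structures using (module LeftModuleMorphisms)

IsBooleanRing : ∀ {b ℓ} → Ring b ℓ → Set (b ⊔ ℓ)
IsBooleanRing B = ∀ x → x * x ≈ x
  where open Ring B

record _⇔ω_ {ℓ} (A : Setω) (C : Set ℓ) : Setω where
  field
    to   : A → C
    from : C → A

module _ {b ℓb r ℓr} (B : Ring b ℓb) (R : CommutativeRing r ℓr)
         (φ : Ring.Carrier B → CommutativeRing.Carrier R) where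

  private
    module B = Ring B
    module R = CommutativeRing R

  InjectiveMap : Set (b ⊔ ℓb ⊔ ℓr)
  InjectiveMap = ∀ x y → φ x R.≈ φ y → x B.≈ y

  -- The tensor product N ⊗_B R, where R is a B-module via φ (c · s = φ c * s),
  -- presented as the abelian group freely generated by symbols n ⊗ s
  -- modulo the abelian-group laws and bilinearity / B-balancedness.
  module Tensor {m ℓm} (N : LeftModule B m ℓm) where
    open LeftModule N

    infixl 6 _`+_
    infix 7 _⊗_
    data Tm : Set (m ⊔ r) where
      `0   : Tm
      _`+_ : Tm → Tm → Tm
      `-_  : Tm → Tm
      _⊗_  : Carrierᴹ → R.Carrier → Tm

    infix 4 _∼_
    data _∼_ : Tm → Tm → Set (b ⊔ m ⊔ ℓm ⊔ r ⊔ ℓr) where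
      ∼-refl   : ∀ {t} → t ∼ t
      ∼-sym    : ∀ {t u} → t ∼ u → u ∼ t
      ∼-trans  : ∀ {t u v} → t ∼ u → u ∼ v → t ∼ v
      +-cong   : ∀ {t t' u u'} → t ∼ t' → u ∼ u' → t `+ u ∼ t' `+ u'
      neg-cong : ∀ {t t'} → t ∼ t' → `- t ∼ `- t'
      +-assoc  : ∀ t u v → (t `+ u) `+ v ∼ t `+ (u `+ v)
      +-comm   : ∀ t u → t `+ u ∼ u `+ t
      +-idˡ    : ∀ t → `0 `+ t ∼ t
      +-invˡ   : ∀ t → (`- t) `+ t ∼ `0
      ⊗-cong   : ∀ {n n' s s'} → n ≈ᴹ n' → s R.≈ s' → n ⊗ s ∼ n' ⊗ s'
      ⊗-distribʳ : ∀ n n' s → (n +ᴹ n') ⊗ s ∼ n ⊗ s `+ n' ⊗ s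
      ⊗-distribˡ : ∀ n s s' → n ⊗ (s R.+ s') ∼ n ⊗ s `+ n ⊗ s'
      ⊗-balanced : ∀ c n s → (c *ₗ n) ⊗ s ∼ n ⊗ (φ c R.* s)

    IsZero : Set (b ⊔ m ⊔ ℓm ⊔ r ⊔ ℓr)
    IsZero = ∀ t → t ∼ `0

  mapTm : ∀ {m ℓm m' ℓm'} (N : LeftModule B m ℓm) (N' : LeftModule B m' ℓm')
          → (LeftModule.Carrierᴹ N → LeftModule.Carrierᴹ N')
          → Tensor.Tm N → Tensor.Tm N'
  mapTm N N' f Tensor.`0 = Tensor.`0
  mapTm N N' f (t Tensor.`+ u) = mapTm N N' f t Tensor.`+ mapTm N N' f u
  mapTm N N' f (Tensor.`- t) = Tensor.`- mapTm N N' f t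
  mapTm N N' f (n Tensor.⊗ s) = f n Tensor.⊗ s

  Flat : Setω
  Flat = ∀ {m ℓm m' ℓm'} (N : LeftModule B m ℓm) (N' : LeftModule B m' ℓm')
         (f : LeftModule.Carrierᴹ N → LeftModule.Carrierᴹ N')
         → LeftModuleMorphisms.IsLeftModuleHomomorphism
             (LeftModule.rawLeftModule N) (LeftModule.rawLeftModule N') f
         → (∀ x y → LeftModule._≈ᴹ_ N' (f x) (f y) → LeftModule._≈ᴹ_ N x y)
         → ∀ t u → Tensor._∼_ N' (mapTm N N' f t) (mapTm N N' f u) → Tensor._∼_ N t u

  Faithful : Setω
  Faithful = ∀ {m ℓm} (N : LeftModule B m ℓm)
             → Tensor.IsZero N → ∀ x → LeftModule._≈ᴹ_ N x (LeftModule.0ᴹ N)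

  record FaithfullyFlat : Setω where
    field
      flat     : Flat
      faithful : Faithful

{-# OPTIONS --safe #-}

-- Over a Boolean ring B every submodule N ⊆ N′ is pure: a finite linear system with constants
-- from N that is solvable in N′ is solvable in N.  Variables can be eliminated one at a time,
-- because equations a_i v = r_i with idempotent coefficients have a common solution iff
-- a_i r_i = r_i and a_j r_i = a_i r_j, conditions not involving v.  A derivation of
-- f t ∼ f u in N′ ⊗ R touches only finitely many elements of N′, subject to finitely many
-- linear equations; solving those equations in N replays it as a derivation of t ∼ u in
-- N ⊗ R.  So R, like every B-module, is flat.
--
-- Faithfulness then needs injectivity of φ: the cyclic module Bx embeds in N, so N ⊗ R = 0
-- forces 1 ⊗ 1 = 0 in Bx ⊗ R ≅ R / φ(ann x) R, which yields an idempotent e with e x = x and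
-- φ e = 0, hence e = 0 and x = 0.  Conversely, if φ x = φ y, then B(x + y) ⊗ R = 0, so a
-- faithful R forces x + y = 0.
module Submission where

open import Level using (_⊔_; 0ℓ)
open import Function using (id; _∘_; _⇔_; mk⇔; Equivalence; _↔_; Inverse)
open import Function.Properties.Inverse using (↔-sym)
open import Data.Empty.Polymorphic using (⊥)
open import Data.Unit using (⊤; tt)
open import Data.Sum as Sum using (_⊎_; inj₁; inj₂; [_,_]; assocˡ; swap)
open import Data.Sum.Algebra using (⊎-assoc; ⊎-identityˡ; ⊎-identityʳ)
open import Data.Product using (∃; _,_; _×_)
open import Data.List using (List; []; _∷_; _++_; map)
open import Data.List.Relation.Unary.All as All using (All; []; _∷_)
import Data.List.Relation.Unary.All.Properties as All
open import Data.List.Relation.Unary.AllPairs using (AllPairs; []; _∷_)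
open import Relation.Binary.PropositionalEquality as ≡ using (_≡_; refl)
import Relation.Binary.Reasoning.Setoid as SetoidReasoning
open import Algebra.Bundles using (Ring; CommutativeRing; AbelianGroup; CommutativeMonoid)
open import Algebra.Morphism.Structures using (IsRingHomomorphism)
import Algebra.Properties.Ring as RingProperties
import Algebra.Properties.AbelianGroup as AbelianGroupProperties
import Algebra.Properties.CommutativeSemigroup as CommutativeSemigroupProperties
open import Algebra.Module.Bundles using (LeftModule)
open import Algebra.Module.Bundles.Raw using (RawLeftModule)
open import Algebra.Module.Morphism.Structures using (IsLeftModuleHomomorphism; IsLeftModuleMonomorphism)
import Algebra.Module.Morphism.LeftModuleMonomorphism as LeftModuleMonomorphism
import Algebra.Module.Properties.LeftModule as LeftModuleProperties
import Algebra.Module.Construct.TensorUnit as TensorUnit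
open import Defs

HasCharacteristicTwo : ∀ {a ℓ} → AbelianGroup a ℓ → Set (a ⊔ ℓ)
HasCharacteristicTwo G = ∀ x → x ∙ x ≈ ε
  where open AbelianGroup G

module CharacteristicTwo {a ℓ} (G : AbelianGroup a ℓ) (x∙x≈ε : HasCharacteristicTwo G) where
  open AbelianGroup G
  open AbelianGroupProperties G using (inverseˡ-unique)

  x⁻¹≈x : ∀ x → x ⁻¹ ≈ x
  x⁻¹≈x x = sym (inverseˡ-unique x x (x∙x≈ε x))

  x∙y≈ε⇔x≈y : ∀ {x y} → x ∙ y ≈ ε ⇔ x ≈ y
  x∙y≈ε⇔x≈y {x} {y} = mk⇔
    (λ xy≈ε → trans (inverseˡ-unique x y xy≈ε) (x⁻¹≈x y))
    (λ x≈y → trans (∙-congʳ x≈y) (x∙x≈ε y))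

  x∙[y∙x]≈y : ∀ x y → x ∙ (y ∙ x) ≈ y
  x∙[y∙x]≈y x y = trans (∙-congˡ (comm y x)) (trans (sym (assoc x x y))
                    (trans (∙-congʳ (x∙x≈ε x)) (identityˡ y)))

module BooleanRing {b ℓ} (B : Ring b ℓ) (idem : IsBooleanRing B) where
  open Ring B
  open RingProperties B using (x+x≈x⇒x≈0; +-identityʳ-unique)
  open CommutativeSemigroupProperties +-commutativeSemigroup using (interchange)
  open SetoidReasoning setoid

  x+x≈0 : ∀ x → x + x ≈ 0#
  x+x≈0 x = x+x≈x⇒x≈0 (x + x) (begin
    (x + x) + (x + x)          ≈⟨ +-cong x[x+x]≈x+x x[x+x]≈x+x ⟨
    x * (x + x) + x * (x + x)  ≈⟨ distribʳ (x + x) x x ⟨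
    (x + x) * (x + x)          ≈⟨ idem (x + x) ⟩
    x + x                      ∎)
    where
    x[x+x]≈x+x : x * (x + x) ≈ x + x
    x[x+x]≈x+x = trans (distribˡ x x x) (+-cong (idem x) (idem x))

  open CharacteristicTwo +-abelianGroup x+x≈0 public
    using () renaming (x∙y≈ε⇔x≈y to x+y≈0⇔x≈y)

  *-comm : ∀ x y → x * y ≈ y * x
  *-comm x y = Equivalence.to x+y≈0⇔x≈y (+-identityʳ-unique (x + y) (x * y + y * x) (begin
    (x + y) + (x * y + y * x)      ≈⟨ +-congˡ (+-comm (x * y) (y * x)) ⟩
    (x + y) + (y * x + x * y)      ≈⟨ interchange x y (y * x) (x * y) ⟩
    (x + y * x) + (y + x * y)      ≈⟨ +-cong (+-congʳ (idem x)) (+-comm (x * y) y) ⟨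
    (x * x + y * x) + (x * y + y)  ≈⟨ +-congˡ (+-congˡ (idem y)) ⟨
    (x * x + y * x) + (x * y + y * y) ≈⟨ +-cong (distribʳ x x y) (distribʳ y x y) ⟨
    (x + y) * x + (x + y) * y      ≈⟨ distribˡ (x + y) x y ⟨
    (x + y) * (x + y)              ≈⟨ idem (x + y) ⟩
    x + y                          ∎))

  [1+x]*x≈0 : ∀ x → (1# + x) * x ≈ 0#
  [1+x]*x≈0 x = begin
    (1# + x) * x    ≈⟨ distribʳ x 1# x ⟩
    1# * x + x * x  ≈⟨ +-cong (*-identityˡ x) (idem x) ⟩
    x + x           ≈⟨ x+x≈0 x ⟩
    0#              ∎

module BooleanModule {b ℓb m ℓm} {B : Ring b ℓb} (idem : IsBooleanRing B)
                     (M : LeftModule B m ℓm) where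
  private module B = Ring B
  open B using (1#; 0#; _+_; _*_; _≈_)
  open LeftModule M
  open SetoidReasoning ≈ᴹ-setoid
  open BooleanRing B idem using (x+x≈0; *-comm; x+y≈0⇔x≈y; [1+x]*x≈0)

  v+v≈0 : ∀ v → v +ᴹ v ≈ᴹ 0ᴹ
  v+v≈0 v = begin
    v +ᴹ v                ≈⟨ +ᴹ-cong (*ₗ-identityˡ v) (*ₗ-identityˡ v) ⟨
    1# *ₗ v +ᴹ 1# *ₗ v    ≈⟨ *ₗ-distribʳ v 1# 1# ⟨
    (1# + 1#) *ₗ v        ≈⟨ *ₗ-congʳ (x+x≈0 1#) ⟩
    0# *ₗ v               ≈⟨ *ₗ-zeroˡ v ⟩
    0ᴹ                    ∎

  open CharacteristicTwo +ᴹ-abelianGroup v+v≈0 public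
    using () renaming (x∙y≈ε⇔x≈y to u+v≈0⇔u≈v; x∙[y∙x]≈y to u+[v+u]≈v)

  *ₗ-idem : ∀ a v → a *ₗ (a *ₗ v) ≈ᴹ a *ₗ v
  *ₗ-idem a v = ≈ᴹ-trans (≈ᴹ-sym (*ₗ-assoc a a v)) (*ₗ-congʳ (idem a))

  *ₗ-swap : ∀ a c v → a *ₗ (c *ₗ v) ≈ᴹ c *ₗ (a *ₗ v)
  *ₗ-swap a c v = ≈ᴹ-trans (≈ᴹ-sym (*ₗ-assoc a c v))
                    (≈ᴹ-trans (*ₗ-congʳ (*-comm a c)) (*ₗ-assoc c a v))

  *ₗ-equalizer : ∀ {a a′ v} → a *ₗ v ≈ᴹ a′ *ₗ v → ∃ λ e → e *ₗ v ≈ᴹ v × e * a ≈ e * a′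
  *ₗ-equalizer {a} {a′} {v} av≈a′v = 1# + d , fixes , equalizes
    where
    d = a + a′
    fixes : (1# + d) *ₗ v ≈ᴹ v
    fixes = begin
      (1# + d) *ₗ v                  ≈⟨ *ₗ-distribʳ v 1# d ⟩
      1# *ₗ v +ᴹ d *ₗ v              ≈⟨ +ᴹ-cong (*ₗ-identityˡ v) (*ₗ-distribʳ v a a′) ⟩
      v +ᴹ (a *ₗ v +ᴹ a′ *ₗ v)       ≈⟨ +ᴹ-congˡ (Equivalence.from u+v≈0⇔u≈v av≈a′v) ⟩
      v +ᴹ 0ᴹ                        ≈⟨ +ᴹ-identityʳ v ⟩
      v                              ∎
    equalizes : (1# + d) * a ≈ (1# + d) * a′
    equalizes = Equivalence.to x+y≈0⇔x≈y (B.trans (B.sym (B.distribˡ (1# + d) a a′)) ([1+x]*x≈0 d))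

  module OneVariable {e} {E : Set e} (coeff : E → Ring.Carrier B) (rhs : E → Carrierᴹ) where

    Solution : Carrierᴹ → List E → Set (e ⊔ ℓm)
    Solution v = All (λ i → coeff i *ₗ v ≈ᴹ rhs i)

    Compatible : List E → Set (e ⊔ ℓm)
    Compatible es = All (λ i → coeff i *ₗ rhs i ≈ᴹ rhs i) es
                  × AllPairs (λ i j → coeff j *ₗ rhs i ≈ᴹ coeff i *ₗ rhs j) es

    solution⇒compatible : ∀ {v es} → Solution v es → Compatible es
    solution⇒compatible [] = [] , []
    solution⇒compatible {v} {i ∷ _} (sᵢ ∷ sol) =
      let fixeds , agreements = solution⇒compatible sol
      in rhs-fixed ∷ fixeds , All.map agree sol ∷ agreements
      where
      rhs-fixed : coeff i *ₗ rhs i ≈ᴹ rhs i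
      rhs-fixed = ≈ᴹ-trans (*ₗ-congˡ (≈ᴹ-sym sᵢ)) (≈ᴹ-trans (*ₗ-idem (coeff i) v) sᵢ)
      agree : ∀ {j} → coeff j *ₗ v ≈ᴹ rhs j → coeff j *ₗ rhs i ≈ᴹ coeff i *ₗ rhs j
      agree {j} sⱼ = ≈ᴹ-trans (*ₗ-congˡ (≈ᴹ-sym sᵢ))
                       (≈ᴹ-trans (*ₗ-swap (coeff j) (coeff i) v) (*ₗ-congˡ sⱼ))

    compatible⇒solution : ∀ {es} → Compatible es → ∃ λ v → Solution v es
    compatible⇒solution ([] , []) = 0ᴹ , []
    compatible⇒solution {i ∷ _} (fixed ∷ fixeds , agreeᵢ ∷ agreements)
      with compatible⇒solution (fixeds , agreements)
    ... | v , sol = v +ᴹ a *ₗ (r +ᴹ v) , solves-i ∷ All.zipWith keeps-solving (sol , agreeᵢ)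
      -- v + a(r + v) is r on the part cut out by the idempotent a, and v on its complement.
      where
      a = coeff i
      r = rhs i
      solves-i : a *ₗ (v +ᴹ a *ₗ (r +ᴹ v)) ≈ᴹ r
      solves-i = begin
        a *ₗ (v +ᴹ a *ₗ (r +ᴹ v))       ≈⟨ *ₗ-distribˡ a v _ ⟩
        a *ₗ v +ᴹ a *ₗ (a *ₗ (r +ᴹ v))  ≈⟨ +ᴹ-congˡ (*ₗ-idem a (r +ᴹ v)) ⟩
        a *ₗ v +ᴹ a *ₗ (r +ᴹ v)         ≈⟨ +ᴹ-congˡ (*ₗ-distribˡ a r v) ⟩
        a *ₗ v +ᴹ (a *ₗ r +ᴹ a *ₗ v)    ≈⟨ +ᴹ-congˡ (+ᴹ-congʳ fixed) ⟩
        a *ₗ v +ᴹ (r +ᴹ a *ₗ v)         ≈⟨ u+[v+u]≈v (a *ₗ v) r ⟩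
        r                               ∎
      keeps-solving : ∀ {j} → coeff j *ₗ v ≈ᴹ rhs j × coeff j *ₗ r ≈ᴹ a *ₗ rhs j
                    → coeff j *ₗ (v +ᴹ a *ₗ (r +ᴹ v)) ≈ᴹ rhs j
      keeps-solving {j} (sⱼ , agree) = begin
        aⱼ *ₗ (v +ᴹ a *ₗ (r +ᴹ v))        ≈⟨ *ₗ-distribˡ aⱼ v _ ⟩
        aⱼ *ₗ v +ᴹ aⱼ *ₗ (a *ₗ (r +ᴹ v))  ≈⟨ +ᴹ-cong sⱼ (*ₗ-swap aⱼ a (r +ᴹ v)) ⟩
        rⱼ +ᴹ a *ₗ (aⱼ *ₗ (r +ᴹ v))       ≈⟨ +ᴹ-congˡ (*ₗ-congˡ (*ₗ-distribˡ aⱼ r v)) ⟩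
        rⱼ +ᴹ a *ₗ (aⱼ *ₗ r +ᴹ aⱼ *ₗ v)   ≈⟨ +ᴹ-congˡ (*ₗ-congˡ (+ᴹ-cong agree sⱼ)) ⟩
        rⱼ +ᴹ a *ₗ (a *ₗ rⱼ +ᴹ rⱼ)        ≈⟨ +ᴹ-congˡ (*ₗ-distribˡ a (a *ₗ rⱼ) rⱼ) ⟩
        rⱼ +ᴹ (a *ₗ (a *ₗ rⱼ) +ᴹ a *ₗ rⱼ) ≈⟨ +ᴹ-congˡ (+ᴹ-congʳ (*ₗ-idem a rⱼ)) ⟩
        rⱼ +ᴹ (a *ₗ rⱼ +ᴹ a *ₗ rⱼ)        ≈⟨ +ᴹ-congˡ (v+v≈0 (a *ₗ rⱼ)) ⟩
        rⱼ +ᴹ 0ᴹ                          ≈⟨ +ᴹ-identityʳ rⱼ ⟩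
        rⱼ                                ∎
        where
        aⱼ = coeff j
        rⱼ = rhs j

infixr 5 _`⊎_
data Code : Set where
  `⊥ `⊤ : Code
  _`⊎_  : Code → Code → Code

-- ⊥ is the level-polymorphic one, so that the isomorphisms of Data.Sum.Algebra apply.
El : Code → Set
El `⊥       = ⊥
El `⊤       = ⊤
El (c `⊎ d) = El c ⊎ El d

module LinearSystems {b ℓb} (B : Ring b ℓb) (idem : IsBooleanRing B) {c} (C : Set c) where
  open Ring B using (Carrier; _+_; _*_; 0#; 1#)

  infixl 6 _⊕_
  infixr 7 _⊛_
  data Expr (V : Set) : Set (b ⊔ c) where
    var : V → Expr V
    con : C → Expr V
    𝟘   : Expr V
    _⊕_ : Expr V → Expr V → Expr V
    _⊛_ : Carrier → Expr V → Expr V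

  Eqn : Set → Set (b ⊔ c)
  Eqn V = Expr V × Expr V

  module _ {V W : Set} (g : V → W) where

    rename : Expr V → Expr W
    rename (var v) = var (g v)
    rename (con k) = con k
    rename 𝟘       = 𝟘
    rename (x ⊕ y) = rename x ⊕ rename y
    rename (a ⊛ x) = a ⊛ rename x

    renameEqn : Eqn V → Eqn W
    renameEqn (x , y) = rename x , rename y

  _⊎ᴱ_ : ∀ {V W} → List (Eqn V) → List (Eqn W) → List (Eqn (V ⊎ W))
  E₁ ⊎ᴱ E₂ = map (renameEqn inj₁) E₁ ++ map (renameEqn inj₂) E₂

  equate : ∀ {V} (d : Code) → (El d → Expr V) → (El d → Expr V) → List (Eqn V)
  equate `⊥        x y = []
  equate `⊤        x y = (x tt , y tt) ∷ []
  equate (d `⊎ d') x y = equate d (x ∘ inj₁) (y ∘ inj₁) ++ equate d' (x ∘ inj₂) (y ∘ inj₂)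

  module _ {V : Set} where

    coeff : Expr (V ⊎ ⊤) → Carrier
    coeff (var (inj₁ v)) = 0#
    coeff (var (inj₂ _)) = 1#
    coeff (con k)        = 0#
    coeff 𝟘              = 0#
    coeff (x ⊕ y)        = coeff x + coeff y
    coeff (a ⊛ x)        = a * coeff x

    rest : Expr (V ⊎ ⊤) → Expr V
    rest (var (inj₁ v)) = var v
    rest (var (inj₂ _)) = 𝟘
    rest (con k)        = con k
    rest 𝟘              = 𝟘
    rest (x ⊕ y)        = rest x ⊕ rest y
    rest (a ⊛ x)        = a ⊛ rest x

    eqnCoeff : Eqn (V ⊎ ⊤) → Carrier
    eqnCoeff (x , y) = coeff (x ⊕ y)

    eqnRest : Eqn (V ⊎ ⊤) → Expr V
    eqnRest (x , y) = rest (x ⊕ y)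

    compatibility : List (Eqn (V ⊎ ⊤)) → List (Eqn V)
    compatibility []       = []
    compatibility (e ∷ es) =
      (eqnCoeff e ⊛ eqnRest e , eqnRest e)
      ∷ map (λ e′ → eqnCoeff e′ ⊛ eqnRest e , eqnCoeff e ⊛ eqnRest e′) es
      ++ compatibility es

  module Semantics {m ℓm} (M : LeftModule B m ℓm) (κ : C → LeftModule.Carrierᴹ M) where
    open LeftModule M
    open SetoidReasoning ≈ᴹ-setoid
    open BooleanModule idem M
    open CommutativeSemigroupProperties (CommutativeMonoid.commutativeSemigroup +ᴹ-commutativeMonoid)
      using (interchange)

    ⟦_⟧ : ∀ {V} → Expr V → (V → Carrierᴹ) → Carrierᴹ
    ⟦ var v ⟧ ρ = ρ v
    ⟦ con k ⟧ ρ = κ k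
    ⟦ 𝟘 ⟧     ρ = 0ᴹ
    ⟦ x ⊕ y ⟧ ρ = ⟦ x ⟧ ρ +ᴹ ⟦ y ⟧ ρ
    ⟦ a ⊛ x ⟧ ρ = a *ₗ ⟦ x ⟧ ρ

    infix 4 _⊨_
    _⊨_ : ∀ {V} → (V → Carrierᴹ) → Eqn V → Set ℓm
    ρ ⊨ (x , y) = ⟦ x ⟧ ρ ≈ᴹ ⟦ y ⟧ ρ

    ⟦⟧-cong : ∀ {V} {ρ ρ′ : V → Carrierᴹ} → (∀ v → ρ v ≈ᴹ ρ′ v) → ∀ x → ⟦ x ⟧ ρ ≈ᴹ ⟦ x ⟧ ρ′
    ⟦⟧-cong ρ≈ρ′ (var v) = ρ≈ρ′ v
    ⟦⟧-cong ρ≈ρ′ (con k) = ≈ᴹ-refl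
    ⟦⟧-cong ρ≈ρ′ 𝟘       = ≈ᴹ-refl
    ⟦⟧-cong ρ≈ρ′ (x ⊕ y) = +ᴹ-cong (⟦⟧-cong ρ≈ρ′ x) (⟦⟧-cong ρ≈ρ′ y)
    ⟦⟧-cong ρ≈ρ′ (a ⊛ x) = *ₗ-congˡ (⟦⟧-cong ρ≈ρ′ x)

    ⊨-cong : ∀ {V} {ρ ρ′ : V → Carrierᴹ} → (∀ v → ρ v ≈ᴹ ρ′ v) → ∀ e → ρ ⊨ e → ρ′ ⊨ e
    ⊨-cong ρ≈ρ′ (x , y) ρ⊨e = ≈ᴹ-trans (≈ᴹ-sym (⟦⟧-cong ρ≈ρ′ x)) (≈ᴹ-trans ρ⊨e (⟦⟧-cong ρ≈ρ′ y))

    ⟦⟧-rename : ∀ {V W} (g : V → W) (ρ : W → Carrierᴹ) x → ⟦ rename g x ⟧ ρ ≡ ⟦ x ⟧ (ρ ∘ g)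
    ⟦⟧-rename g ρ (var v) = refl
    ⟦⟧-rename g ρ (con k) = refl
    ⟦⟧-rename g ρ 𝟘       = refl
    ⟦⟧-rename g ρ (x ⊕ y) = ≡.cong₂ _+ᴹ_ (⟦⟧-rename g ρ x) (⟦⟧-rename g ρ y)
    ⟦⟧-rename g ρ (a ⊛ x) = ≡.cong (a *ₗ_) (⟦⟧-rename g ρ x)

    ⊨-rename : ∀ {V W} (g : V → W) {ρ : W → Carrierᴹ} e → ρ ⊨ renameEqn g e ⇔ ρ ∘ g ⊨ e
    ⊨-rename g {ρ} (x , y) rewrite ⟦⟧-rename g ρ x | ⟦⟧-rename g ρ y = mk⇔ (λ p → p) (λ p → p)

    ⊨-⊎ᴱ : ∀ {V W} {ρ : V ⊎ W → Carrierᴹ} {E₁ E₂}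
         → All (ρ ⊨_) (E₁ ⊎ᴱ E₂) ⇔ (All (ρ ∘ inj₁ ⊨_) E₁ × All (ρ ∘ inj₂ ⊨_) E₂)
    ⊨-⊎ᴱ {E₁ = E₁} = mk⇔
      (λ h → let h₁ , h₂ = All.++⁻ (map (renameEqn inj₁) E₁) h
             in All.map (λ {e} → to (⊨-rename inj₁ e)) (All.map⁻ h₁)
              , All.map (λ {e} → to (⊨-rename inj₂ e)) (All.map⁻ h₂))
      (λ (h₁ , h₂) → All.++⁺ (All.map⁺ (All.map (λ {e} → from (⊨-rename inj₁ e)) h₁))
                             (All.map⁺ (All.map (λ {e} → from (⊨-rename inj₂ e)) h₂)))
      where open Equivalence

    ⊨-equate : ∀ {V} {ρ : V → Carrierᴹ} d {x y : El d → Expr V}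
             → All (ρ ⊨_) (equate d x y) ⇔ (∀ p → ρ ⊨ (x p , y p))
    ⊨-equate `⊥ = mk⇔ (λ _ ()) (λ _ → [])
    ⊨-equate `⊤ = mk⇔ (λ { (h ∷ []) tt → h }) (λ h → h tt ∷ [])
    ⊨-equate (d `⊎ d′) {x} = mk⇔
      (λ h → let h₁ , h₂ = All.++⁻ (equate d (x ∘ inj₁) _) h
             in [ to (⊨-equate d) h₁ , to (⊨-equate d′) h₂ ])
      (λ h → All.++⁺ (from (⊨-equate d) (h ∘ inj₁)) (from (⊨-equate d′) (h ∘ inj₂)))
      where open Equivalence

    0*ₗt+ᴹu≈u : ∀ t u → 0# *ₗ t +ᴹ u ≈ᴹ u
    0*ₗt+ᴹu≈u t u = ≈ᴹ-trans (+ᴹ-congʳ (*ₗ-zeroˡ t)) (+ᴹ-identityˡ u)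

    ⟦⟧-split : ∀ {V} (ρ : V ⊎ ⊤ → Carrierᴹ) x
             → ⟦ x ⟧ ρ ≈ᴹ coeff x *ₗ ρ (inj₂ tt) +ᴹ ⟦ rest x ⟧ (ρ ∘ inj₁)
    ⟦⟧-split ρ (var (inj₁ v)) = ≈ᴹ-sym (0*ₗt+ᴹu≈u (ρ (inj₂ tt)) (ρ (inj₁ v)))
    ⟦⟧-split ρ (var (inj₂ _)) = ≈ᴹ-sym (≈ᴹ-trans (+ᴹ-identityʳ _) (*ₗ-identityˡ _))
    ⟦⟧-split ρ (con k)        = ≈ᴹ-sym (0*ₗt+ᴹu≈u (ρ (inj₂ tt)) (κ k))
    ⟦⟧-split ρ 𝟘              = ≈ᴹ-sym (0*ₗt+ᴹu≈u (ρ (inj₂ tt)) 0ᴹ)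
    ⟦⟧-split ρ (x ⊕ y)        = begin
      ⟦ x ⟧ ρ +ᴹ ⟦ y ⟧ ρ
        ≈⟨ +ᴹ-cong (⟦⟧-split ρ x) (⟦⟧-split ρ y) ⟩
      (coeff x *ₗ t +ᴹ ⟦ rest x ⟧ ρ₁) +ᴹ (coeff y *ₗ t +ᴹ ⟦ rest y ⟧ ρ₁)
        ≈⟨ interchange _ _ _ _ ⟩
      (coeff x *ₗ t +ᴹ coeff y *ₗ t) +ᴹ (⟦ rest x ⟧ ρ₁ +ᴹ ⟦ rest y ⟧ ρ₁)
        ≈⟨ +ᴹ-congʳ (*ₗ-distribʳ t (coeff x) (coeff y)) ⟨
      (coeff x + coeff y) *ₗ t +ᴹ (⟦ rest x ⟧ ρ₁ +ᴹ ⟦ rest y ⟧ ρ₁)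
        ∎
      where
      t = ρ (inj₂ tt)
      ρ₁ = ρ ∘ inj₁
    ⟦⟧-split ρ (a ⊛ x)        = begin
      a *ₗ ⟦ x ⟧ ρ                                       ≈⟨ *ₗ-congˡ (⟦⟧-split ρ x) ⟩
      a *ₗ (coeff x *ₗ t +ᴹ ⟦ rest x ⟧ ρ₁)              ≈⟨ *ₗ-distribˡ a _ _ ⟩
      a *ₗ (coeff x *ₗ t) +ᴹ a *ₗ ⟦ rest x ⟧ ρ₁          ≈⟨ +ᴹ-congʳ (*ₗ-assoc a (coeff x) t) ⟨
      (a * coeff x) *ₗ t +ᴹ a *ₗ ⟦ rest x ⟧ ρ₁           ∎
      where
      t = ρ (inj₂ tt)
      ρ₁ = ρ ∘ inj₁

    ⊨-linear : ∀ {V} {ρ : V ⊎ ⊤ → Carrierᴹ} e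
             → ρ ⊨ e ⇔ eqnCoeff e *ₗ ρ (inj₂ tt) ≈ᴹ ⟦ eqnRest e ⟧ (ρ ∘ inj₁)
    ⊨-linear {ρ = ρ} (x , y) = mk⇔
      (λ h → to u+v≈0⇔u≈v (≈ᴹ-trans (≈ᴹ-sym (⟦⟧-split ρ (x ⊕ y))) (from u+v≈0⇔u≈v h)))
      (λ h → to u+v≈0⇔u≈v (≈ᴹ-trans (⟦⟧-split ρ (x ⊕ y)) (from u+v≈0⇔u≈v h)))
      where open Equivalence

    ⊨-compatibility : ∀ {V} (σ : V → Carrierᴹ) es
                    → All (σ ⊨_) (compatibility es)
                      ⇔ OneVariable.Compatible eqnCoeff (λ e → ⟦ eqnRest e ⟧ σ) es
    ⊨-compatibility σ []       = mk⇔ (λ _ → [] , []) (λ _ → [])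
    ⊨-compatibility σ (e ∷ es) = mk⇔
      (λ { (d ∷ h) → let hᵉ , hs = All.++⁻ (map _ es) h
                         ds , cs = to (⊨-compatibility σ es) hs
                     in d ∷ ds , All.map⁻ hᵉ ∷ cs })
      (λ { (d ∷ ds , c ∷ cs) → d ∷ All.++⁺ (All.map⁺ c) (from (⊨-compatibility σ es) (ds , cs)) })
      where open Equivalence

module Purity {b ℓb m ℓm m′ ℓm′} {B : Ring b ℓb} (idem : IsBooleanRing B)
  (N : LeftModule B m ℓm) (N′ : LeftModule B m′ ℓm′)
  (f : LeftModule.Carrierᴹ N → LeftModule.Carrierᴹ N′)
  (f-hom : IsLeftModuleHomomorphism (LeftModule.rawLeftModule N) (LeftModule.rawLeftModule N′) f)
  (f-injective : ∀ x y → LeftModule._≈ᴹ_ N′ (f x) (f y) → LeftModule._≈ᴹ_ N x y)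
  where
  private
    module N = LeftModule N
    module N′ = LeftModule N′
    module f = IsLeftModuleHomomorphism f-hom
  open LinearSystems B idem N.Carrierᴹ
  open Semantics N id
  open Semantics N′ f using () renaming
    (⟦_⟧ to ⟦_⟧′; _⊨_ to _⊨′_; ⊨-cong to ⊨′-cong; ⊨-rename to ⊨′-rename; ⊨-linear to ⊨′-linear;
     ⊨-compatibility to ⊨′-compatibility)
  open Equivalence

  SolutionsDescend : Set → Set (b ⊔ m ⊔ ℓm ⊔ m′ ⊔ ℓm′)
  SolutionsDescend V = ∀ (E : List (Eqn V)) (ρ : V → N′.Carrierᴹ)
                       → All (ρ ⊨′_) E → ∃ λ (σ : V → N.Carrierᴹ) → All (σ ⊨_) E

  f-⟦⟧ : ∀ {V} (σ : V → N.Carrierᴹ) x → f (⟦ x ⟧ σ) N′.≈ᴹ ⟦ x ⟧′ (f ∘ σ)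
  f-⟦⟧ σ (var v) = N′.≈ᴹ-refl
  f-⟦⟧ σ (con k) = N′.≈ᴹ-refl
  f-⟦⟧ σ 𝟘       = f.0ᴹ-homo
  f-⟦⟧ σ (x ⊕ y) = N′.≈ᴹ-trans (f.+ᴹ-homo _ _) (N′.+ᴹ-cong (f-⟦⟧ σ x) (f-⟦⟧ σ y))
  f-⟦⟧ σ (a ⊛ x) = N′.≈ᴹ-trans (f.*ₗ-homo a _) (N′.*ₗ-congˡ (f-⟦⟧ σ x))

  ⊨-reflect : ∀ {V} (σ : V → N.Carrierᴹ) e → f ∘ σ ⊨′ e → σ ⊨ e
  ⊨-reflect σ (x , y) h = f-injective _ _
    (N′.≈ᴹ-trans (f-⟦⟧ σ x) (N′.≈ᴹ-trans h (N′.≈ᴹ-sym (f-⟦⟧ σ y))))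

  descend-⊥ : SolutionsDescend ⊥
  descend-⊥ E ρ ρ⊨E = σ , All.map (λ {e} → ⊨-reflect σ e ∘ ⊨′-cong (λ ()) e) ρ⊨E
    where
    σ : ⊥ → N.Carrierᴹ
    σ ()

  descend-↔ : ∀ {V W} → V ↔ W → SolutionsDescend W → SolutionsDescend V
  descend-↔ V↔W descendW E ρ ρ⊨E =
    let σ , σ⊨E′ = descendW E′ (ρ ∘ V↔W.from) ρ∘from⊨E′
    in σ ∘ V↔W.to , All.map (λ {e} → to (⊨-rename V↔W.to e)) (All.map⁻ σ⊨E′)
    where
    module V↔W = Inverse V↔W
    E′ = map (renameEqn V↔W.to) E
    ρ≈ρ∘from∘to : ∀ v → ρ v N′.≈ᴹ ρ (V↔W.from (V↔W.to v))
    ρ≈ρ∘from∘to v = N′.≈ᴹ-reflexive (≡.cong ρ (≡.sym (V↔W.strictlyInverseʳ v)))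
    ρ∘from⊨E′ : All (ρ ∘ V↔W.from ⊨′_) E′
    ρ∘from⊨E′ = All.map⁺ (All.map (λ {e} → from (⊨′-rename V↔W.to e) ∘ ⊨′-cong ρ≈ρ∘from∘to e) ρ⊨E)

  descend-⊎⊤ : ∀ {V} → SolutionsDescend V → SolutionsDescend (V ⊎ ⊤)
  descend-⊎⊤ descendV E ρ ρ⊨E =
    let σ , σ⊨compatibility = descendV (compatibility E) (ρ ∘ inj₁) ρ∘inj₁⊨compatibility
        v , v-solves = OneVariable.compatible⇒solution idem N eqnCoeff (λ e → ⟦ eqnRest e ⟧ σ)
                         (to (⊨-compatibility σ E) σ⊨compatibility)
    in [ σ , (λ _ → v) ] , All.map (λ {e} → from (⊨-linear e)) v-solves
    where
    open BooleanModule using (module OneVariable)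
    ρ∘inj₁⊨compatibility : All (ρ ∘ inj₁ ⊨′_) (compatibility E)
    ρ∘inj₁⊨compatibility = from (⊨′-compatibility (ρ ∘ inj₁) E)
      (OneVariable.solution⇒compatible idem N′ eqnCoeff (λ e → ⟦ eqnRest e ⟧′ (ρ ∘ inj₁))
         (All.map (λ {e} → to (⊨′-linear e)) ρ⊨E))

  descend-⊎ : ∀ {V} d → SolutionsDescend V → SolutionsDescend (V ⊎ El d)
  descend-⊎ `⊥         descendV = descend-↔ (⊎-identityʳ 0ℓ _) descendV
  descend-⊎ `⊤         descendV = descend-⊎⊤ descendV
  descend-⊎ (d `⊎ d′) descendV =
    descend-↔ (↔-sym (⊎-assoc 0ℓ _ _ _)) (descend-⊎ d′ (descend-⊎ d descendV))

  solutionsDescend : ∀ d → SolutionsDescend (El d)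
  solutionsDescend d = descend-↔ (↔-sym (⊎-identityˡ 0ℓ _)) (descend-⊎ d descend-⊥)

module TensorTerms {b ℓb r ℓr} (B : Ring b ℓb) (R : CommutativeRing r ℓr)
                   (φ : Ring.Carrier B → CommutativeRing.Carrier R) where
  private
    module R = CommutativeRing R
  module T = Tensor B R φ
  open T using (Tm; `0; _`+_; `-_; _⊗_)
  open LeftModule using (Carrierᴹ)

  module _ {m ℓm} {M : LeftModule B m ℓm} where

    shape : Tm M → Code
    shape `0       = `⊥
    shape (t `+ u) = shape t `⊎ shape u
    shape (`- t)   = shape t
    shape (n ⊗ s)  = `⊤

    leaf : (t : Tm M) → El (shape t) → Carrierᴹ M
    leaf (t `+ u) (inj₁ p) = leaf t p
    leaf (t `+ u) (inj₂ p) = leaf u p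
    leaf (`- t)   p        = leaf t p
    leaf (n ⊗ s)  _        = n

  module _ {m ℓm m′ ℓm′} {M : LeftModule B m ℓm} {M′ : LeftModule B m′ ℓm′} where

    relabel : (t : Tm M) → (El (shape t) → Carrierᴹ M′) → Tm M′
    relabel `0       κ = `0
    relabel (t `+ u) κ = relabel t (κ ∘ inj₁) `+ relabel u (κ ∘ inj₂)
    relabel (`- t)   κ = `- relabel t κ
    relabel (n ⊗ s)  κ = κ tt ⊗ s

    relabel-cong : ∀ t {κ κ′ : El (shape t) → Carrierᴹ M′}
                 → (∀ p → LeftModule._≈ᴹ_ M′ (κ p) (κ′ p)) → T._∼_ M′ (relabel t κ) (relabel t κ′)
    relabel-cong `0       κ≈κ′ = T.∼-refl
    relabel-cong (t `+ u) κ≈κ′ = T.+-cong (relabel-cong t (κ≈κ′ ∘ inj₁)) (relabel-cong u (κ≈κ′ ∘ inj₂))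
    relabel-cong (`- t)   κ≈κ′ = T.neg-cong (relabel-cong t κ≈κ′)
    relabel-cong (n ⊗ s)  κ≈κ′ = T.⊗-cong (κ≈κ′ tt) R.refl

  module _ {m ℓm m′ ℓm′} {M : LeftModule B m ℓm} {M′ : LeftModule B m′ ℓm′}
           (g : Carrierᴹ M → Carrierᴹ M′) where

    preimageLeaf : (t : Tm M) → El (shape (mapTm B R φ M M′ g t)) → Carrierᴹ M
    preimageLeaf (t `+ u) (inj₁ p) = preimageLeaf t p
    preimageLeaf (t `+ u) (inj₂ p) = preimageLeaf u p
    preimageLeaf (`- t)   p        = preimageLeaf t p
    preimageLeaf (n ⊗ s)  _        = n

    leaf-mapTm : ∀ t p → leaf (mapTm B R φ M M′ g t) p ≡ g (preimageLeaf t p)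
    leaf-mapTm (t `+ u) (inj₁ p) = leaf-mapTm t p
    leaf-mapTm (t `+ u) (inj₂ p) = leaf-mapTm u p
    leaf-mapTm (`- t)   p        = leaf-mapTm t p
    leaf-mapTm (n ⊗ s)  _        = refl

    relabel-mapTm : ∀ t {κ} → (∀ p → LeftModule._≈ᴹ_ M (κ p) (preimageLeaf t p))
                  → T._∼_ M (relabel (mapTm B R φ M M′ g t) κ) t
    relabel-mapTm `0       κ≈ = T.∼-refl
    relabel-mapTm (t `+ u) κ≈ = T.+-cong (relabel-mapTm t (κ≈ ∘ inj₁)) (relabel-mapTm u (κ≈ ∘ inj₂))
    relabel-mapTm (`- t)   κ≈ = T.neg-cong (relabel-mapTm t κ≈)
    relabel-mapTm (n ⊗ s)  κ≈ = T.⊗-cong (κ≈ tt) R.refl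

  module _ {m ℓm} {M : LeftModule B m ℓm} where
    private module TM = T M
    open TM using (_∼_)

    z+z∼z⇒z∼0 : ∀ {z} → z `+ z ∼ z → z ∼ `0
    z+z∼z⇒z∼0 {z} z+z∼z =
      TM.∼-trans (TM.∼-sym (TM.+-idˡ z))
        (TM.∼-trans (TM.+-cong (TM.∼-sym (TM.+-invˡ z)) TM.∼-refl)
          (TM.∼-trans (TM.+-assoc (`- z) z z)
            (TM.∼-trans (TM.+-cong TM.∼-refl z+z∼z) (TM.+-invˡ z))))

    -0∼0 : `- `0 ∼ `0
    -0∼0 = TM.∼-trans (TM.∼-sym (TM.+-idˡ _)) (TM.∼-trans (TM.+-comm _ _) (TM.+-invˡ `0))

    ⊗-zeroʳ : ∀ n → n ⊗ R.0# ∼ `0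
    ⊗-zeroʳ n = z+z∼z⇒z∼0 (TM.∼-trans (TM.∼-sym (TM.⊗-distribˡ n R.0# R.0#))
                                       (TM.⊗-cong (LeftModule.≈ᴹ-refl M) (R.+-identityˡ R.0#)))

    generators-vanish⇒IsZero : (∀ n s → n ⊗ s ∼ `0) → TM.IsZero
    generators-vanish⇒IsZero ⊗∼0 `0       = TM.∼-refl
    generators-vanish⇒IsZero ⊗∼0 (t `+ u) =
      TM.∼-trans (TM.+-cong (generators-vanish⇒IsZero ⊗∼0 t) (generators-vanish⇒IsZero ⊗∼0 u))
                 (TM.+-idˡ `0)
    generators-vanish⇒IsZero ⊗∼0 (`- t)   =
      TM.∼-trans (TM.neg-cong (generators-vanish⇒IsZero ⊗∼0 t)) -0∼0
    generators-vanish⇒IsZero ⊗∼0 (n ⊗ s)  = ⊗∼0 n s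

module Flatness {b ℓb r ℓr} {B : Ring b ℓb} (idem : IsBooleanRing B) (R : CommutativeRing r ℓr)
                (φ : Ring.Carrier B → CommutativeRing.Carrier R) where
  private
    module R = CommutativeRing R
  open TensorTerms B R φ
  open T using (Tm; `0; _`+_; `-_; _⊗_)

  module _ {m ℓm m′ ℓm′} (N : LeftModule B m ℓm) (N′ : LeftModule B m′ ℓm′)
           (f : LeftModule.Carrierᴹ N → LeftModule.Carrierᴹ N′) where
    private
      module N = LeftModule N
      module N′ = LeftModule N′
      module TN = T N
      module TN′ = T N′
    open LinearSystems B idem N.Carrierᴹ
    open Semantics N id
    open Semantics N′ f using () renaming (_⊨_ to _⊨′_; ⊨-⊎ᴱ to ⊨′-⊎ᴱ; ⊨-equate to ⊨′-equate)
    open Equivalence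

    -- vars name the leaves of w₁ and w₂ and those of the intermediate terms of a derivation.
    record Schema (w₁ w₂ : Tm N′) : Set (b ⊔ m ⊔ ℓm ⊔ m′ ⊔ ℓm′ ⊔ r ⊔ ℓr) where
      field
        vars        : Code
        value       : El vars → N′.Carrierᴹ
        left        : El (shape w₁) → El vars
        right       : El (shape w₂) → El vars
        left-value  : ∀ p → value (left p) N′.≈ᴹ leaf w₁ p
        right-value : ∀ p → value (right p) N′.≈ᴹ leaf w₂ p
        eqns        : List (Eqn (El vars))
        eqns-hold   : All (value ⊨′_) eqns
        derive      : ∀ σ → All (σ ⊨_) eqns → relabel w₁ (σ ∘ left) TN.∼ relabel w₂ (σ ∘ right)

    reindexing : ∀ {w₁ w₂} (right : El (shape w₂) → El (shape w₁))
               → (∀ p → leaf w₁ (right p) N′.≈ᴹ leaf w₂ p)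
               → (∀ σ → relabel w₁ σ TN.∼ relabel w₂ (σ ∘ right))
               → Schema w₁ w₂
    reindexing {w₁} right right-value derive = record
      { vars = shape w₁ ; value = leaf w₁ ; left = id ; right = right
      ; left-value = λ _ → N′.≈ᴹ-refl ; right-value = right-value
      ; eqns = [] ; eqns-hold = [] ; derive = λ σ _ → derive σ }

    constrained : ∀ {w₁ w₂} (eqns : List (Eqn (El (shape w₁ `⊎ shape w₂))))
                → All ([ leaf w₁ , leaf w₂ ] ⊨′_) eqns
                → (∀ σ → All (σ ⊨_) eqns → relabel w₁ (σ ∘ inj₁) TN.∼ relabel w₂ (σ ∘ inj₂))
                → Schema w₁ w₂
    constrained {w₁} {w₂} eqns eqns-hold derive = record
      { vars = shape w₁ `⊎ shape w₂ ; value = [ leaf w₁ , leaf w₂ ] ; left = inj₁ ; right = inj₂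
      ; left-value = λ _ → N′.≈ᴹ-refl ; right-value = λ _ → N′.≈ᴹ-refl
      ; eqns = eqns ; eqns-hold = eqns-hold ; derive = derive }

    schema-sym : ∀ {w₁ w₂} → Schema w₁ w₂ → Schema w₂ w₁
    schema-sym S = record
      { vars = vars ; value = value ; left = right ; right = left
      ; left-value = right-value ; right-value = left-value
      ; eqns = eqns ; eqns-hold = eqns-hold ; derive = λ σ h → TN.∼-sym (derive σ h) }
      where open Schema S

    schema-trans : ∀ {w₁ w₂ w₃} → Schema w₁ w₂ → Schema w₂ w₃ → Schema w₁ w₃
    schema-trans {w₂ = w₂} S₁ S₂ = record
      { vars = S₁.vars `⊎ S₂.vars ; value = [ S₁.value , S₂.value ]
      ; left = inj₁ ∘ S₁.left ; right = inj₂ ∘ S₂.right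
      ; left-value = S₁.left-value ; right-value = S₂.right-value
      ; eqns = (S₁.eqns ⊎ᴱ S₂.eqns) ++ glue
      ; eqns-hold = All.++⁺ (from ⊨′-⊎ᴱ (S₁.eqns-hold , S₂.eqns-hold))
                            (from (⊨′-equate (shape w₂))
                                  (λ p → N′.≈ᴹ-trans (S₁.right-value p) (N′.≈ᴹ-sym (S₂.left-value p))))
      ; derive = derive }
      where
      module S₁ = Schema S₁
      module S₂ = Schema S₂
      glue : List (Eqn (El (S₁.vars `⊎ S₂.vars)))
      glue = equate (shape w₂) (var ∘ inj₁ ∘ S₁.right) (var ∘ inj₂ ∘ S₂.left)
      derive : ∀ σ → All (σ ⊨_) ((S₁.eqns ⊎ᴱ S₂.eqns) ++ glue)
             → relabel _ (σ ∘ inj₁ ∘ S₁.left) TN.∼ relabel _ (σ ∘ inj₂ ∘ S₂.right)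
      derive σ σ⊨eqns =
        let σ⊨eqns₁₂ , σ⊨glue = All.++⁻ (S₁.eqns ⊎ᴱ S₂.eqns) σ⊨eqns
            σ⊨eqns₁ , σ⊨eqns₂ = to ⊨-⊎ᴱ σ⊨eqns₁₂
        in TN.∼-trans (S₁.derive (σ ∘ inj₁) σ⊨eqns₁)
             (TN.∼-trans (relabel-cong w₂ (to (⊨-equate (shape w₂)) σ⊨glue))
                         (S₂.derive (σ ∘ inj₂) σ⊨eqns₂))

    schema-+ : ∀ {t t′ u u′} → Schema t t′ → Schema u u′ → Schema (t `+ u) (t′ `+ u′)
    schema-+ St Su = record
      { vars = St.vars `⊎ Su.vars ; value = [ St.value , Su.value ]
      ; left = Sum.map St.left Su.left ; right = Sum.map St.right Su.right
      ; left-value = [ St.left-value , Su.left-value ] ; right-value = [ St.right-value , Su.right-value ]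
      ; eqns = St.eqns ⊎ᴱ Su.eqns
      ; eqns-hold = from ⊨′-⊎ᴱ (St.eqns-hold , Su.eqns-hold)
      ; derive = λ σ h → let ht , hu = to ⊨-⊎ᴱ h
                         in TN.+-cong (St.derive (σ ∘ inj₁) ht) (Su.derive (σ ∘ inj₂) hu) }
      where
      module St = Schema St
      module Su = Schema Su

    schema-neg : ∀ {t t′} → Schema t t′ → Schema (`- t) (`- t′)
    schema-neg S = record
      { vars = vars ; value = value ; left = left ; right = right
      ; left-value = left-value ; right-value = right-value
      ; eqns = eqns ; eqns-hold = eqns-hold ; derive = λ σ h → TN.neg-cong (derive σ h) }
      where open Schema S

    schema : ∀ {w₁ w₂} → w₁ TN′.∼ w₂ → Schema w₁ w₂
    schema TN′.∼-refl              = reindexing id (λ _ → N′.≈ᴹ-refl) (λ _ → TN.∼-refl)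
    schema (TN′.∼-sym D)           = schema-sym (schema D)
    schema (TN′.∼-trans D₁ D₂)     = schema-trans (schema D₁) (schema D₂)
    schema (TN′.+-cong Dt Du)      = schema-+ (schema Dt) (schema Du)
    schema (TN′.neg-cong D)        = schema-neg (schema D)
    schema (TN′.+-assoc t u v)     =
      reindexing assocˡ [ (λ _ → N′.≈ᴹ-refl) , [ (λ _ → N′.≈ᴹ-refl) , (λ _ → N′.≈ᴹ-refl) ] ]
                 (λ _ → TN.+-assoc _ _ _)
    schema (TN′.+-comm t u)        =
      reindexing swap [ (λ _ → N′.≈ᴹ-refl) , (λ _ → N′.≈ᴹ-refl) ] (λ _ → TN.+-comm _ _)
    schema (TN′.+-idˡ t)           = reindexing inj₂ (λ _ → N′.≈ᴹ-refl) (λ _ → TN.+-idˡ _)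
    schema (TN′.+-invˡ t)          = record
      { vars = shape t ; value = leaf t ; left = [ id , id ] ; right = λ ()
      ; left-value = [ (λ _ → N′.≈ᴹ-refl) , (λ _ → N′.≈ᴹ-refl) ] ; right-value = λ ()
      ; eqns = [] ; eqns-hold = [] ; derive = λ _ _ → TN.+-invˡ _ }
    schema (TN′.⊗-cong n≈n′ s≈s′)  = reindexing id (λ _ → n≈n′) (λ _ → TN.⊗-cong N.≈ᴹ-refl s≈s′)
    schema (TN′.⊗-distribˡ n s s′) =
      reindexing _ [ (λ _ → N′.≈ᴹ-refl) , (λ _ → N′.≈ᴹ-refl) ] (λ _ → TN.⊗-distribˡ _ s s′)
    schema (TN′.⊗-distribʳ n n′ s) =
      constrained ((var (inj₁ tt) , var (inj₂ (inj₁ tt)) ⊕ var (inj₂ (inj₂ tt))) ∷ []) (N′.≈ᴹ-refl ∷ [])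
                  (λ { σ (h ∷ []) → TN.∼-trans (TN.⊗-cong h R.refl) (TN.⊗-distribʳ _ _ s) })
    schema (TN′.⊗-balanced c n s)  =
      constrained ((var (inj₁ tt) , c ⊛ var (inj₂ tt)) ∷ []) (N′.≈ᴹ-refl ∷ [])
                  (λ { σ (h ∷ []) → TN.∼-trans (TN.⊗-cong h R.refl) (TN.⊗-balanced c _ s) })

  flat : Flat B R φ
  flat N N′ f f-hom f-injective t u ft∼fu =
    let σ , σ⊨E = solutionsDescend vars (eqns ++ pin t left ++ pin u right) value
                    (All.++⁺ eqns-hold (All.++⁺ (pin-hold t left left-value) (pin-hold u right right-value)))
        σ⊨eqns , σ⊨pins = All.++⁻ eqns σ⊨E
        σ⊨pinₜ , σ⊨pinᵤ = All.++⁻ (pin t left) σ⊨pins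
    in TN.∼-trans (TN.∼-sym (relabel-mapTm f t (to (⊨-equate _) σ⊨pinₜ)))
         (TN.∼-trans (derive σ σ⊨eqns) (relabel-mapTm f u (to (⊨-equate _) σ⊨pinᵤ)))
    where
    module N′ = LeftModule N′
    module TN = T N
    open LinearSystems B idem (LeftModule.Carrierᴹ N)
    open Semantics N id using (⊨-equate)
    open Semantics N′ f using () renaming (_⊨_ to _⊨′_; ⊨-equate to ⊨′-equate)
    open Purity idem N N′ f f-hom f-injective using (solutionsDescend)
    open Schema (schema N N′ f ft∼fu)
    open Equivalence

    pin : ∀ t → (El (shape (mapTm B R φ N N′ f t)) → El vars) → List (Eqn (El vars))
    pin t ι = equate (shape (mapTm B R φ N N′ f t)) (var ∘ ι) (con ∘ preimageLeaf f t)

    pin-hold : ∀ t ι → (∀ p → value (ι p) N′.≈ᴹ leaf (mapTm B R φ N N′ f t) p) → All (value ⊨′_) (pin t ι)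
    pin-hold t ι ι-value = from (⊨′-equate _)
      (λ p → N′.≈ᴹ-trans (ι-value p) (N′.≈ᴹ-reflexive (leaf-mapTm f t p)))

module Cyclic {b ℓb m ℓm} {B : Ring b ℓb} (M : LeftModule B m ℓm) (x : LeftModule.Carrierᴹ M) where
  open Ring B using (Carrier; _+_; _*_; -_; 0#; -‿inverseˡ)
  open LeftModule M
  open LeftModuleProperties M using (inverseˡ-uniqueᴹ)

  rawCyclic : RawLeftModule Carrier b ℓm
  rawCyclic = record
    { Carrierᴹ = Carrier ; _≈ᴹ_ = λ a c → a *ₗ x ≈ᴹ c *ₗ x
    ; _+ᴹ_ = _+_ ; _*ₗ_ = _*_ ; 0ᴹ = 0# ; -ᴹ_ = -_ }

  -*ₗx≈-ᴹ[*ₗx] : ∀ a → (- a) *ₗ x ≈ᴹ -ᴹ (a *ₗ x)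
  -*ₗx≈-ᴹ[*ₗx] a = inverseˡ-uniqueᴹ ((- a) *ₗ x) (a *ₗ x)
    (≈ᴹ-trans (≈ᴹ-sym (*ₗ-distribʳ x (- a) a)) (≈ᴹ-trans (*ₗ-congʳ (-‿inverseˡ a)) (*ₗ-zeroˡ x)))

  *ₗx-isMonomorphism : IsLeftModuleMonomorphism rawCyclic rawLeftModule (_*ₗ x)
  *ₗx-isMonomorphism = record
    { isLeftModuleHomomorphism = record
      { +ᴹ-isGroupHomomorphism = record
        { isMonoidHomomorphism = record
          { isMagmaHomomorphism = record
            { isRelHomomorphism = record { cong = id }
            ; homo = λ a c → *ₗ-distribʳ x a c }
          ; ε-homo = *ₗ-zeroˡ x }
        ; ⁻¹-homo = -*ₗx≈-ᴹ[*ₗx] }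
      ; *ₗ-homo = λ c a → *ₗ-assoc c a x }
    ; injective = id }

  cyclic : LeftModule B b ℓm
  cyclic = record
    { isLeftModule = LeftModuleMonomorphism.isLeftModule *ₗx-isMonomorphism (Ring.isRing B) isLeftModule }

module Faithfulness {b ℓb r ℓr} {B : Ring b ℓb} (idem : IsBooleanRing B) (R : CommutativeRing r ℓr)
  (φ : Ring.Carrier B → CommutativeRing.Carrier R)
  (φ-hom : IsRingHomomorphism (Ring.rawRing B) (CommutativeRing.rawRing R) φ) where
  private
    module B = Ring B
    module R = CommutativeRing R
    module φ = IsRingHomomorphism φ-hom
  open BooleanRing B idem using (*-comm; x+x≈0; x+y≈0⇔x≈y)
  open TensorTerms B R φ
  open T using (Tm; `0; _`+_; `-_; _⊗_)
  open RingProperties R.ring using (-‿distribʳ-*)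

  φ[a*b]*r≈φa*[φb*r] : ∀ a b r → φ (a B.* b) R.* r R.≈ φ a R.* (φ b R.* r)
  φ[a*b]*r≈φa*[φb*r] a b r = R.trans (R.*-congʳ (φ.*-homo a b)) (R.*-assoc (φ a) (φ b) r)

  module Support {m ℓm} (N : LeftModule B m ℓm) (x : LeftModule.Carrierᴹ N) where
    open LeftModule N
    open BooleanModule idem N using (*ₗ-equalizer)

    -- Equality in R / φ(ann x) R ≅ ⟨x⟩ ⊗ R: over a Boolean ring, r − s lies in φ(ann x) R
    -- iff it is killed by φ e for some idempotent e with e x = x.
    infix 4 _≈ₓ_
    _≈ₓ_ : R.Carrier → R.Carrier → Set (b ⊔ ℓm ⊔ ℓr)
    r ≈ₓ s = ∃ λ e → e *ₗ x ≈ᴹ x × φ e R.* r R.≈ φ e R.* s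

    fixes-* : ∀ {e e′} → e *ₗ x ≈ᴹ x → e′ *ₗ x ≈ᴹ x → (e B.* e′) *ₗ x ≈ᴹ x
    fixes-* {e} {e′} ex≈x e′x≈x = ≈ᴹ-trans (*ₗ-assoc e e′ x) (≈ᴹ-trans (*ₗ-congˡ e′x≈x) ex≈x)

    scaleˡ : ∀ c {e r s} → φ e R.* r R.≈ φ e R.* s → φ (c B.* e) R.* r R.≈ φ (c B.* e) R.* s
    scaleˡ c {e} {r} {s} p = R.trans (φ[a*b]*r≈φa*[φb*r] c e r)
                               (R.trans (R.*-congˡ p) (R.sym (φ[a*b]*r≈φa*[φb*r] c e s)))

    scaleʳ : ∀ c {e r s} → φ e R.* r R.≈ φ e R.* s → φ (e B.* c) R.* r R.≈ φ (e B.* c) R.* s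
    scaleʳ c {e} {r} {s} p = R.trans (R.*-congʳ (φ.⟦⟧-cong (*-comm e c)))
                               (R.trans (scaleˡ c p) (R.*-congʳ (φ.⟦⟧-cong (*-comm c e))))

    ≈⇒≈ₓ : ∀ {r s} → r R.≈ s → r ≈ₓ s
    ≈⇒≈ₓ r≈s = B.1# , *ₗ-identityˡ x , R.*-congˡ r≈s

    ≈ₓ-sym : ∀ {r s} → r ≈ₓ s → s ≈ₓ r
    ≈ₓ-sym (e , fix , p) = e , fix , R.sym p

    ≈ₓ-trans : ∀ {r s t} → r ≈ₓ s → s ≈ₓ t → r ≈ₓ t
    ≈ₓ-trans (e , fix , p) (e′ , fix′ , p′) =
      e B.* e′ , fixes-* fix fix′ , R.trans (scaleʳ e′ p) (scaleˡ e p′)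

    ≈ₓ-+ : ∀ {r r′ s s′} → r ≈ₓ r′ → s ≈ₓ s′ → r R.+ s ≈ₓ r′ R.+ s′
    ≈ₓ-+ (e , fix , p) (e′ , fix′ , p′) = e B.* e′ , fixes-* fix fix′ ,
      R.trans (R.distribˡ _ _ _) (R.trans (R.+-cong (scaleʳ e′ p) (scaleˡ e p′)) (R.sym (R.distribˡ _ _ _)))

    ≈ₓ-neg : ∀ {r s} → r ≈ₓ s → R.- r ≈ₓ R.- s
    ≈ₓ-neg (e , fix , p) = e , fix ,
      R.trans (R.sym (-‿distribʳ-* _ _)) (R.trans (R.-‿cong p) (-‿distribʳ-* _ _))

    ⟨x⟩ : LeftModule B b ℓm
    ⟨x⟩ = Cyclic.cyclic N x

    evaluate : Tm ⟨x⟩ → R.Carrier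
    evaluate `0       = R.0#
    evaluate (t `+ u) = evaluate t R.+ evaluate u
    evaluate (`- t)   = R.- evaluate t
    evaluate (a ⊗ s)  = φ a R.* s

    evaluate-cong : ∀ {t u} → T._∼_ ⟨x⟩ t u → evaluate t ≈ₓ evaluate u
    evaluate-cong T.∼-refl                = ≈⇒≈ₓ R.refl
    evaluate-cong (T.∼-sym D)             = ≈ₓ-sym (evaluate-cong D)
    evaluate-cong (T.∼-trans D D′)        = ≈ₓ-trans (evaluate-cong D) (evaluate-cong D′)
    evaluate-cong (T.+-cong D D′)         = ≈ₓ-+ (evaluate-cong D) (evaluate-cong D′)
    evaluate-cong (T.neg-cong D)          = ≈ₓ-neg (evaluate-cong D)
    evaluate-cong (T.+-assoc t u v)       = ≈⇒≈ₓ (R.+-assoc _ _ _)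
    evaluate-cong (T.+-comm t u)          = ≈⇒≈ₓ (R.+-comm _ _)
    evaluate-cong (T.+-idˡ t)             = ≈⇒≈ₓ (R.+-identityˡ _)
    evaluate-cong (T.+-invˡ t)            = ≈⇒≈ₓ (R.-‿inverseˡ _)
    evaluate-cong (T.⊗-cong {a} {a′} {s} {s′} ax≈a′x s≈s′) =
      let e , fix , ea≈ea′ = *ₗ-equalizer ax≈a′x
      in e , fix , R.trans (R.sym (φ[a*b]*r≈φa*[φb*r] e a s))
                     (R.trans (R.*-congʳ (φ.⟦⟧-cong ea≈ea′))
                       (R.trans (φ[a*b]*r≈φa*[φb*r] e a′ s) (R.*-congˡ (R.*-congˡ s≈s′))))
    evaluate-cong (T.⊗-distribʳ a a′ s)   =
      ≈⇒≈ₓ (R.trans (R.*-congʳ (φ.+-homo a a′)) (R.distribʳ s (φ a) (φ a′)))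
    evaluate-cong (T.⊗-distribˡ a s s′)   = ≈⇒≈ₓ (R.distribˡ (φ a) s s′)
    evaluate-cong (T.⊗-balanced c a s)    =
      ≈⇒≈ₓ (R.trans (R.*-congʳ (R.trans (φ.*-homo c a) (R.*-comm (φ c) (φ a)))) (R.*-assoc (φ a) (φ c) s))

  faithful : Flat B R φ → InjectiveMap B R φ → Faithful B R φ
  faithful flat φ-injective N N⊗R≈0 x =
    let e , ex≈x , φe≈φe*0 = evaluate-cong 1⊗1∼0
        e≈0 = φ-injective e B.0# (R.trans (φe≈0 φe≈φe*0) (R.sym φ.0#-homo))
    in ≈ᴹ-trans (≈ᴹ-sym ex≈x) (≈ᴹ-trans (*ₗ-congʳ e≈0) (*ₗ-zeroˡ x))
    where
    open LeftModule N
    open Support N x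
    open Cyclic N x using (*ₗx-isMonomorphism)
    open IsLeftModuleMonomorphism *ₗx-isMonomorphism using (isLeftModuleHomomorphism)

    1⊗1∼0 : T._∼_ ⟨x⟩ (B.1# ⊗ R.1#) `0
    1⊗1∼0 = flat ⟨x⟩ N (_*ₗ x) isLeftModuleHomomorphism (λ _ _ → id) (B.1# ⊗ R.1#) `0 (N⊗R≈0 _)

    φe≈0 : ∀ {e} → φ e R.* (φ B.1# R.* R.1#) R.≈ φ e R.* R.0# → φ e R.≈ R.0#
    φe≈0 {e} φe≈φe*0 = R.trans (R.sym (R.*-identityʳ (φ e)))
      (R.trans (R.*-congˡ (R.sym (R.trans (R.*-identityʳ _) φ.1#-homo))) (R.trans φe≈φe*0 (R.zeroʳ (φ e))))

  faithful⇒injective : Faithful B R φ → InjectiveMap B R φ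
  faithful⇒injective R-faithful x y φx≈φy = to x+y≈0⇔x≈y e≈0
    where
    open Equivalence
    e = x B.+ y
    φe≈0 : φ e R.≈ R.0#
    φe≈0 = R.trans (φ.+-homo x y) (R.trans (R.+-congʳ φx≈φy)
             (R.trans (R.sym (φ.+-homo y y)) (R.trans (φ.⟦⟧-cong (x+x≈0 y)) φ.0#-homo)))
    ⟨e⟩ : LeftModule B b ℓb
    ⟨e⟩ = Cyclic.cyclic (TensorUnit.leftModule {R = B}) e
    a≈ea : ∀ a → a B.* e B.≈ (e B.* a) B.* e
    a≈ea a = B.sym (B.trans (B.*-congʳ (*-comm e a)) (B.trans (B.*-assoc a e e) (B.*-congˡ (idem e))))
    ⟨e⟩⊗R≈0 : T.IsZero ⟨e⟩
    ⟨e⟩⊗R≈0 = generators-vanish⇒IsZero λ a s →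
      T.∼-trans (T.⊗-cong (a≈ea a) R.refl)
        (T.∼-trans (T.⊗-balanced e a s)
          (T.∼-trans (T.⊗-cong (B.refl) (R.trans (R.*-congʳ φe≈0) (R.zeroˡ s))) (⊗-zeroʳ a)))
    e≈0 : e B.≈ B.0#
    e≈0 = B.trans (B.sym (B.*-identityˡ e)) (B.trans (R-faithful ⟨e⟩ ⟨e⟩⊗R≈0 B.1#) (B.zeroˡ e))

corollary3p4 : ∀ {b ℓb r ℓr} (B : Ring b ℓb) (R : CommutativeRing r ℓr)
    (φ : Ring.Carrier B → CommutativeRing.Carrier R)
    → IsBooleanRing B
    → IsRingHomomorphism (Ring.rawRing B) (CommutativeRing.rawRing R) φ
    → FaithfullyFlat B R φ ⇔ω InjectiveMap B R φ
corollary3p4 B R φ idem φ-hom = record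
  { to   = λ ff → faithful⇒injective (FaithfullyFlat.faithful ff)
  ; from = λ φ-injective → record { flat = flat ; faithful = faithful flat φ-injective } }
  where
  open Flatness {B = B} idem R φ using (flat)
  open Faithfulness idem R φ φ-hom using (faithful; faithful⇒injective)
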